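{- Let $I=(A,\succ,c)$ be an SF instance. Consider the integer linear program with binary variables $w_{ij},h_{ij},f_{ij}\in\{0,1\}$ for all $a_i,a_j\in A$, objective $\min\sum_{a_i,a_j\in A}h_{ij}$, and constraints (2) $\sum_{a_j\in A\setminus\{a_i\}}(\tfrac12h_{ij}+f_{ij})\le c_i$ for all $a_i\in A$; (3) $h_{ij}+f_{ij}\le1$ for all $a_i,a_j\in A$; (4) $h_{ij}=h_{ji}$ for all $a_i,a_j\in A$; (5) $f_{ij}=f_{ji}$ for all $a_i,a_j\in A$; (6) $f_{ij}+w_{ij}+w_{ji}\ge1$ for all distinct $a_i,a_j\in A$; (7) $\sum_{a_k:\,a_k\succeq_i a_j}(\tfrac12h_{ik}+f_{ik})\ge c_iw_{ij}$ for all $a_i,a_j\in A$; (8) $w_{ij},h_{ij},f_{ij}\in\{0,1\}$ for all $a_i,a_j\in A$. For a 0/1 assignment $\langle\mathbf w,\mathbf h,\mathbf f\rangle$ define its associated half-matching by $M^{\text{half}}=\{\{a_i,a_j\}: i\neq j,\ h_{ij}=1\}$ (pairs of weight $\tfrac12$) and $M^{\text{full}}=\{\{a_i,a_j\}: i\neq j,\ f_{ij}=1\}$ (pairs of weight $1$). Then: if $\langle\mathbf w,\mathbf h,\mathbf f\rangle$ is a feasible solution of the ILP, its associated half-matching $(M^{\text{half}},M^{\text{full}})$ is a stable half-matching of $I$; and conversely, for every stable half-matching $(M^{\text{half}},M^{\text{full}})$ of $I$ there is a feasible solution of the ILP whose associated half-matching is $(M^{\text{half}},M^{\text{full}})$.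
   Context: A Stable Fixtures (SF) instance is $I=(A,\succ,c)$ where $A=\{a_1,\dots,a_n\}$ is a finite set of $n$ agents; each agent $a_i$ has a strict linear order $\succ_i$ over $A\setminus\{a_i\}$ (complete preference list), with the convention that every agent ranks itself last ($a_j\succ_i a_i$ for all $j\neq i$); $a\succeq_i b$ means $a\succ_i b$ or $a=b$. Each agent has an integer capacity $c_i$ with $1\le c_i<n$. A half-matching is given by disjoint sets $M^{\text{half}},M^{\text{full}}$ of unordered pairs of distinct agents (weight $\tfrac12$ and $1$ respectively), equivalently a weight function $w$ on pairs with values in $\{0,\tfrac12,1\}$, such that $\sum_{j\neq i}w(\{a_i,a_j\})\le c_i$ for every $a_i$. It is stable if for every pair $e=\{a_i,a_j\}$ of distinct agents, either $w(e)=1$ or some $a_k\in e$ satisfies $\sum_{f\ni a_k,\ f\succeq_k e}w(f)=c_k$, where $a_k$ ranks pairs containing it by the rank of the other agent in $\succ_k$ (i.e., $a_k$ is filled to capacity with partners at least as good as the other agent of $e$). -}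

module Defs where

open import Data.Nat using (ℕ; zero; suc; _+_; _*_; _≤_; _<_; _≤?_)
open import Data.Fin using (Fin; zero; suc; _≟_)
open import Data.Bool using (Bool; true; false; if_then_else_)
open import Data.Product using (_×_; Σ; ∃; ∃-syntax; _,_)
open import Data.Sum using (_⊎_)
open import Relation.Nullary using (¬_; Dec; yes; no; ¬?)
open import Relation.Nullary.Decidable using (_×-dec_)
open import Relation.Binary.PropositionalEquality using (_≡_; _≢_)

Σ-Fin : ∀ {n} → (Fin n → ℕ) → ℕ
Σ-Fin {zero}  f = 0
Σ-Fin {suc n} f = f zero + Σ-Fin (λ k → f (suc k))

Σ-Fin-if : ∀ {n} {P : Fin n → Set} → ((k : Fin n) → Dec (P k)) → (Fin n → ℕ) → ℕ
Σ-Fin-if P? f = Σ-Fin (λ k → sel (P? k) (f k))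
  where
  sel : ∀ {Q : Set} → Dec Q → ℕ → ℕ
  sel (yes _) x = x
  sel (no  _) _ = 0

-- An SF instance on agents Fin n.  The strict linear order ≻_i of agent i is
-- encoded by an injective rank function: j ≻_i k  iff  rank i j < rank i k.
-- Every agent ranks itself last.
record SF (n : ℕ) : Set where
  field
    rank      : Fin n → Fin n → ℕ
    rank-inj  : ∀ i j k → rank i j ≡ rank i k → j ≡ k
    self-last : ∀ i j → j ≢ i → rank i j < rank i i
    cap       : Fin n → ℕ
    cap-pos   : ∀ i → 1 ≤ cap i
    cap-lt    : ∀ i → cap i < n

module _ {n : ℕ} (I : SF n) where
  open SF I

  _⪰[_]?_ : (k i j : Fin n) → Dec (rank i k ≤ rank i j)
  k ⪰[ i ]? j = rank i k ≤? rank i j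

  -- All weights below are DOUBLED (weight 1/2 ↦ 1, weight 1 ↦ 2) to stay in ℕ.

  -- Half-matchings: M^half, M^full as sets of unordered pairs of distinct
  -- agents, i.e. symmetric irreflexive Boolean relations.
  dweight : (H F : Fin n → Fin n → Bool) → Fin n → Fin n → ℕ
  dweight H F i j = (if H i j then 1 else 0) + (if F i j then 2 else 0)

  record IsHalfMatching (H F : Fin n → Fin n → Bool) : Set where
    field
      H-sym    : ∀ i j → H i j ≡ H j i
      F-sym    : ∀ i j → F i j ≡ F j i
      H-irrefl : ∀ i → H i i ≡ false
      F-irrefl : ∀ i → F i i ≡ false
      disjoint : ∀ i j → ¬ (H i j ≡ true × F i j ≡ true)
      capacity : ∀ i → Σ-Fin-if (λ j → ¬? (j ≟ i)) (dweight H F i) ≤ 2 * cap i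

  Saturated : (H F : Fin n → Fin n → Bool) → Fin n → Fin n → Set
  Saturated H F k l =
    Σ-Fin-if (λ m → ¬? (m ≟ k) ×-dec (m ⪰[ k ]? l)) (dweight H F k) ≡ 2 * cap k

  record IsStableHalfMatching (H F : Fin n → Fin n → Bool) : Set where
    field
      isHalfMatching : IsHalfMatching H F
      stable : ∀ i j → i ≢ j → F i j ≡ true ⊎ (Saturated H F i j ⊎ Saturated H F j i)

  -- The ILP (constraints (2),(7) multiplied by 2).
  record Feasible (w h f : Fin n → Fin n → ℕ) : Set where
    field
      c2 : ∀ i → Σ-Fin-if (λ j → ¬? (j ≟ i)) (λ j → h i j + 2 * f i j) ≤ 2 * cap i
      c3 : ∀ i j → h i j + f i j ≤ 1
      c4 : ∀ i j → h i j ≡ h j i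
      c5 : ∀ i j → f i j ≡ f j i
      c6 : ∀ i j → i ≢ j → 1 ≤ f i j + w i j + w j i
      c7 : ∀ i j → 2 * cap i * w i j ≤ Σ-Fin-if (λ k → k ⪰[ i ]? j) (λ k → h i k + 2 * f i k)
      c8w : ∀ i j → w i j ≡ 0 ⊎ w i j ≡ 1
      c8h : ∀ i j → h i j ≡ 0 ⊎ h i j ≡ 1
      c8f : ∀ i j → f i j ≡ 0 ⊎ f i j ≡ 1

assoc : ∀ {n} → (Fin n → Fin n → ℕ) → Fin n → Fin n → Bool
assoc x i j with i ≟ j | x i j
... | yes _ | _ = false
... | no  _ | 1 = true
... | no  _ | _ = false

-- With all weights doubled, a 0/1 pair (h_ij, f_ij) contributes exactly
-- h_ij + 2 f_ij to agent i, so the ILP load of i is its load in the associated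
-- half-matching; constraints (2)–(5) then say that we have a half-matching. The
-- variable w_ij certifies that a_i is saturated by partners at least as good as a_j:
-- (7) with w_ij = 1 forces the load over {k ⪰_i j} up to 2 c_i, and (2) caps it there
-- (the agent itself is not in this set because it ranks itself last). Constraint (6)
-- is then exactly the stability condition. Conversely, a stable half-matching yields
-- a feasible solution by taking h, f as its indicators and w_ij = [a_i saturated
-- with respect to a_j].
module Submission where

open import Defs
open import Data.Nat using (ℕ; zero; suc; _+_; _*_; _≤_; z≤n)
import Data.Nat as ℕ
open import Data.Nat.Properties
  using (≤-refl; ≤-trans; ≤-reflexive; ≤-antisym; +-mono-≤; <⇒≱; m≤m+n; m≤n+m; *-identityʳ; *-zeroʳ; <-irrefl;
         module ≤-Reasoning)
open import Data.Fin as Fin using (Fin; _≟_)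
open import Data.Bool using (Bool; true; false; if_then_else_)
open import Data.Product using (_×_; ∃-syntax; _,_; proj₁; proj₂)
open import Data.Sum using (_⊎_; inj₁; inj₂)
open import Function using (_∘_)
open import Relation.Nullary using (¬_; Dec; yes; no; ¬?; contradiction)
open import Relation.Nullary.Decidable using (_×-dec_; does; dec-true)
open import Relation.Binary.PropositionalEquality
  using (_≡_; _≢_; refl; sym; trans; cong; cong₂; module ≡-Reasoning)

Σ-Fin-if-mono : ∀ {n} {P Q : Fin n → Set} (P? : ∀ k → Dec (P k)) (Q? : ∀ k → Dec (Q k))
  {f g : Fin n → ℕ} → (∀ k → P k → Q k) → (∀ k → P k → f k ≤ g k) →
  Σ-Fin-if P? f ≤ Σ-Fin-if Q? g
Σ-Fin-if-mono {zero}  _  _  _   _   = z≤n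
Σ-Fin-if-mono {suc n} P? Q? P⇒Q f≤g
  with P? Fin.zero | Q? Fin.zero
     | Σ-Fin-if-mono (P? ∘ Fin.suc) (Q? ∘ Fin.suc) (P⇒Q ∘ Fin.suc) (f≤g ∘ Fin.suc)
... | yes p | yes _  | tail = +-mono-≤ (f≤g Fin.zero p) tail
... | yes p | no ¬q  | _    = contradiction (P⇒Q Fin.zero p) ¬q
... | no _  | _      | tail = +-mono-≤ z≤n tail

Σ-Fin-if-cong : ∀ {n} {P : Fin n → Set} (P? : ∀ k → Dec (P k)) {f g : Fin n → ℕ} →
  (∀ k → P k → f k ≡ g k) → Σ-Fin-if P? f ≡ Σ-Fin-if P? g
Σ-Fin-if-cong P? f≡g = ≤-antisym
  (Σ-Fin-if-mono P? P? (λ _ p → p) (λ k p → ≤-reflexive (f≡g k p)))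
  (Σ-Fin-if-mono P? P? (λ _ p → p) (λ k p → ≤-reflexive (sym (f≡g k p))))

indicator : Bool → ℕ
indicator b = if b then 1 else 0

indicator₂ : ∀ {n} → (Fin n → Fin n → Bool) → Fin n → Fin n → ℕ
indicator₂ X i j = indicator (X i j)

indicator-binary : ∀ b → indicator b ≡ 0 ⊎ indicator b ≡ 1
indicator-binary false = inj₁ refl
indicator-binary true  = inj₂ refl

indicator-injective : ∀ {a b} → indicator a ≡ indicator b → a ≡ b
indicator-injective {false} {false} _ = refl
indicator-injective {true}  {true}  _ = refl

assoc-irrefl : ∀ {n} (x : Fin n → Fin n → ℕ) i → assoc x i i ≡ false
assoc-irrefl x i with i ≟ i
... | yes _ = refl
... | no i≢i = contradiction refl i≢i

assoc-true⇒1 : ∀ {n} (x : Fin n → Fin n → ℕ) {i j} → assoc x i j ≡ true → x i j ≡ 1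
assoc-true⇒1 x {i} {j} eq with i ≟ j | x i j
... | no _ | suc zero = refl
... | yes _ | _ with () ← eq
... | no _ | zero with () ← eq
... | no _ | suc (suc _) with () ← eq

indicator-assoc : ∀ {n} (x : Fin n → Fin n → ℕ) {i j} → i ≢ j →
  x i j ≡ 0 ⊎ x i j ≡ 1 → indicator (assoc x i j) ≡ x i j
indicator-assoc x {i} {j} i≢j binary with i ≟ j | x i j | binary
... | yes i≡j | _ | _ = contradiction i≡j i≢j
... | no _ | zero     | _ = refl
... | no _ | suc zero | _ = refl
... | no _ | suc (suc _) | inj₁ ()
... | no _ | suc (suc _) | inj₂ ()

assoc-sym : ∀ {n} (x : Fin n → Fin n → ℕ) → (∀ i j → x i j ≡ x j i) →
  (∀ i j → x i j ≡ 0 ⊎ x i j ≡ 1) → ∀ i j → assoc x i j ≡ assoc x j i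
-- Splitting on i ≟ j with `with` would abstract it inside assoc x i j but not the
-- j ≟ i inside assoc x j i, hence the explicit case function.
assoc-sym x x-sym binary i j = by-cases (i ≟ j)
  where
  open ≡-Reasoning
  by-cases : Dec (i ≡ j) → assoc x i j ≡ assoc x j i
  by-cases (yes refl) = refl
  by-cases (no i≢j) = indicator-injective (begin
    indicator (assoc x i j) ≡⟨ indicator-assoc x i≢j (binary i j) ⟩
    x i j                   ≡⟨ x-sym i j ⟩
    x j i                   ≡⟨ sym (indicator-assoc x (i≢j ∘ sym) (binary j i)) ⟩
    indicator (assoc x j i) ∎)

assoc-indicator₂ : ∀ {n} (X : Fin n → Fin n → Bool) → (∀ i → X i i ≡ false) →
  ∀ i j → assoc (indicator₂ X) i j ≡ X i j
assoc-indicator₂ X X-irrefl i j = by-cases (i ≟ j)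
  where
  by-cases : Dec (i ≡ j) → assoc (indicator₂ X) i j ≡ X i j
  by-cases (yes refl) = trans (assoc-irrefl (indicator₂ X) i) (sym (X-irrefl i))
  by-cases (no i≢j) = indicator-injective (indicator-assoc (indicator₂ X) i≢j (indicator-binary (X i j)))

module _ {n : ℕ} (I : SF n) where
  open SF I

  dweight-indicator : ∀ (H F : Fin n → Fin n → Bool) i j →
    dweight I H F i j ≡ indicator (H i j) + 2 * indicator (F i j)
  dweight-indicator H F i j with H i j | F i j
  ... | false | false = refl
  ... | false | true  = refl
  ... | true  | false = refl
  ... | true  | true  = refl

  ⪰-excludes-self : ∀ {i j k} → i ≢ j → rank i k ≤ rank i j → k ≢ i
  ⪰-excludes-self i≢j k⪰j refl = <⇒≱ (self-last _ _ (i≢j ∘ sym)) k⪰j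

  module _ {w h f : Fin n → Fin n → ℕ} (feasible : Feasible I w h f) where
    open Feasible feasible

    dweight-assoc : ∀ i j → j ≢ i → dweight I (assoc h) (assoc f) i j ≡ h i j + 2 * f i j
    dweight-assoc i j j≢i = trans (dweight-indicator (assoc h) (assoc f) i j)
      (cong₂ _+_ (indicator-assoc h (j≢i ∘ sym) (c8h i j))
                 (cong (2 *_) (indicator-assoc f (j≢i ∘ sym) (c8f i j))))

    assoc-isHalfMatching : IsHalfMatching I (assoc h) (assoc f)
    assoc-isHalfMatching = record
      { H-sym    = assoc-sym h c4 c8h
      ; F-sym    = assoc-sym f c5 c8f
      ; H-irrefl = assoc-irrefl h
      ; F-irrefl = assoc-irrefl f
      ; disjoint = disjoint
      ; capacity = λ i → ≤-trans
          (≤-reflexive (Σ-Fin-if-cong (λ j → ¬? (j ≟ i)) (dweight-assoc i))) (c2 i)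
      }
      where
      disjoint : ∀ i j → ¬ (assoc h i j ≡ true × assoc f i j ≡ true)
      disjoint i j (hij , fij) = <-irrefl refl (begin
        2             ≡⟨ cong₂ _+_ (sym (assoc-true⇒1 h hij)) (sym (assoc-true⇒1 f fij)) ⟩
        h i j + f i j ≤⟨ c3 i j ⟩
        1             ∎)
        where open ≤-Reasoning

    w⇒saturated : ∀ i j → i ≢ j → w i j ≡ 1 → Saturated I (assoc h) (assoc f) i j
    w⇒saturated i j i≢j wij≡1 = ≤-antisym
      (≤-trans (Σ-Fin-if-mono P? (λ k → ¬? (k ≟ i)) (λ _ → proj₁)
                 (λ k p → ≤-reflexive (dweight-assoc i k (proj₁ p))))
               (c2 i))
      (begin
        2 * cap i                ≡⟨ sym (*-identityʳ (2 * cap i)) ⟩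
        2 * cap i * 1            ≡⟨ cong (2 * cap i *_) (sym wij≡1) ⟩
        2 * cap i * w i j        ≤⟨ c7 i j ⟩
        Σ-Fin-if (λ k → rank i k ℕ.≤? rank i j) (λ k → h i k + 2 * f i k)
          ≤⟨ Σ-Fin-if-mono (λ k → rank i k ℕ.≤? rank i j) P? (λ k k⪰j → ⪰-excludes-self i≢j k⪰j , k⪰j)
               (λ k k⪰j → ≤-reflexive (sym (dweight-assoc i k (⪰-excludes-self i≢j k⪰j)))) ⟩
        Σ-Fin-if P? (dweight I (assoc h) (assoc f) i) ∎)
      where
      open ≤-Reasoning
      P? : ∀ m → Dec (m ≢ i × rank i m ≤ rank i j)
      P? m = ¬? (m ≟ i) ×-dec (rank i m ℕ.≤? rank i j)

    feasible⇒stable : IsStableHalfMatching I (assoc h) (assoc f)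
    feasible⇒stable = record { isHalfMatching = assoc-isHalfMatching ; stable = stable }
      where
      stable : ∀ i j → i ≢ j →
        assoc f i j ≡ true ⊎ (Saturated I (assoc h) (assoc f) i j ⊎ Saturated I (assoc h) (assoc f) j i)
      stable i j i≢j with c8f i j | c8w i j | c8w j i
      ... | inj₂ fij≡1 | _ | _ = inj₁ (indicator-injective (trans (indicator-assoc f i≢j (c8f i j)) fij≡1))
      ... | inj₁ _ | inj₂ wij≡1 | _ = inj₂ (inj₁ (w⇒saturated i j i≢j wij≡1))
      ... | inj₁ _ | inj₁ _ | inj₂ wji≡1 = inj₂ (inj₂ (w⇒saturated j i (i≢j ∘ sym) wji≡1))
      ... | inj₁ fij≡0 | inj₁ wij≡0 | inj₁ wji≡0 = contradiction
        (≤-trans (c6 i j i≢j) (≤-reflexive (cong₂ _+_ (cong₂ _+_ fij≡0 wij≡0) wji≡0))) (<-irrefl refl)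

  module _ {H F : Fin n → Fin n → Bool} (isStable : IsStableHalfMatching I H F) where
    open IsStableHalfMatching isStable
    open IsHalfMatching isHalfMatching

    saturated? : ∀ i j → Dec (Saturated I H F i j)
    saturated? i j = _ ℕ.≟ _

    saturation : Fin n → Fin n → ℕ
    saturation i j = indicator (does (saturated? i j))

    saturation-saturated : ∀ i j → Saturated I H F i j → saturation i j ≡ 1
    saturation-saturated i j sat = cong indicator (dec-true (saturated? i j) sat)

    load-dweight : ∀ i k → indicator (H i k) + 2 * indicator (F i k) ≡ dweight I H F i k
    load-dweight i k = sym (dweight-indicator H F i k)

    indicator-disjoint : ∀ i j → indicator (H i j) + indicator (F i j) ≤ 1
    indicator-disjoint i j with H i j | F i j | disjoint i j
    ... | true  | true  | ¬both = contradiction (refl , refl) ¬both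
    ... | true  | false | _ = ≤-refl
    ... | false | true  | _ = ≤-refl
    ... | false | false | _ = z≤n

    stable⇒blocked : ∀ i j → i ≢ j → 1 ≤ indicator (F i j) + saturation i j + saturation j i
    stable⇒blocked i j i≢j with stable i j i≢j
    ... | inj₁ Fij rewrite Fij = ℕ.s≤s z≤n
    ... | inj₂ (inj₁ sat) rewrite saturation-saturated i j sat =
      ≤-trans (m≤n+m 1 (indicator (F i j))) (m≤m+n _ (saturation j i))
    ... | inj₂ (inj₂ sat) rewrite saturation-saturated j i sat =
      m≤n+m 1 (indicator (F i j) + saturation i j)

    saturation-load : ∀ i j → 2 * cap i * saturation i j ≤
      Σ-Fin-if (λ k → rank i k ℕ.≤? rank i j) (λ k → indicator (H i k) + 2 * indicator (F i k))
    saturation-load i j = bound (saturated? i j)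
      where
      bound : (sat? : Dec (Saturated I H F i j)) → 2 * cap i * indicator (does sat?) ≤
        Σ-Fin-if (λ k → rank i k ℕ.≤? rank i j) (λ k → indicator (H i k) + 2 * indicator (F i k))
      bound (no _) rewrite *-zeroʳ (2 * cap i) = z≤n
      bound (yes sat) rewrite *-identityʳ (2 * cap i) = ≤-trans (≤-reflexive (sym sat))
        (Σ-Fin-if-mono (λ k → ¬? (k ≟ i) ×-dec (rank i k ℕ.≤? rank i j)) (λ k → rank i k ℕ.≤? rank i j)
          (λ _ → proj₂) (λ k _ → ≤-reflexive (sym (load-dweight i k))))

    stable⇒feasible : Feasible I saturation (indicator₂ H) (indicator₂ F)
    stable⇒feasible = record
      { c2  = λ i → ≤-trans
          (≤-reflexive (Σ-Fin-if-cong (λ j → ¬? (j ≟ i)) (λ k _ → load-dweight i k))) (capacity i)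
      ; c3  = indicator-disjoint
      ; c4  = λ i j → cong indicator (H-sym i j)
      ; c5  = λ i j → cong indicator (F-sym i j)
      ; c6  = stable⇒blocked
      ; c7  = saturation-load
      ; c8w = λ i j → indicator-binary (does (saturated? i j))
      ; c8h = λ i j → indicator-binary (H i j)
      ; c8f = λ i j → indicator-binary (F i j)
      }

theorem15 : ∀ {n : ℕ} (I : SF n) →
    (∀ (w h f : Fin n → Fin n → ℕ) → Feasible I w h f →
        IsStableHalfMatching I (assoc h) (assoc f))
    × (∀ (H F : Fin n → Fin n → Bool) → IsStableHalfMatching I H F →
        ∃[ w ] ∃[ h ] ∃[ f ] (Feasible I w h f
          × (∀ i j → assoc h i j ≡ H i j) × (∀ i j → assoc f i j ≡ F i j)))
theorem15 I =
    (λ w h f → feasible⇒stable I)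
  , (λ H F isStable → let open IsHalfMatching (IsStableHalfMatching.isHalfMatching isStable) in
       saturation I isStable , indicator₂ H , indicator₂ F , stable⇒feasible I isStable
     , assoc-indicator₂ H H-irrefl , assoc-indicator₂ F F-irrefl)
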